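{- Let $n\ge1$, $\mathcal{B}$ a non-trivial Boolean algebra and $\nu\in\mathcal{F}^{\mathcal{B}}_{C_n}$. Then the map $\mathsf{b}$ from formulas to $|\mathcal{B}|$ given by $\mathsf{b}(\alpha):=\nu(\alpha)_{[1]}$ is a $\mathcal{B}$-valuation for $C_n$, and for every formula $\alpha$, $\mathsf{b}(\alpha)=1$ iff $\nu(\alpha)\in D^{\mathcal{B}}_n$.
   Context: $\Sigma$ is the signature with unary $\neg$ and binary $\wedge,\vee,\to$; formulas are built from countably many variables. For a formula $\alpha$: $\alpha^0=\alpha$, $\alpha^{k+1}=\neg(\alpha^k\wedge\neg(\alpha^k))$; $\alpha^\circ=\alpha^1$; $\alpha^{(1)}=\alpha^1$, $\alpha^{(k+1)}=\alpha^{(k)}\wedge\alpha^{k+1}$. A $\mathcal{B}$-valuation for $C_n$ (for a non-trivial Boolean algebra $\mathcal{B}$ with complement $\sim$ and $a\to b=\sim a\vee b$) is a map $\mathsf{b}$ from formulas to $|\mathcal{B}|$ such that for all formulas: (V1) $\mathsf{b}(\alpha\#\beta)=\mathsf{b}(\alpha)\#\mathsf{b}(\beta)$ for $\#\in\{\wedge,\vee,\to\}$; (V2) $\sim\mathsf{b}(\alpha)\le\mathsf{b}(\neg\alpha)$; (V3) $\mathsf{b}(\neg\neg\alpha)\le\mathsf{b}(\alpha)$; (V4)$_n$ $\mathsf{b}(\alpha^n)=\sim(\mathsf{b}(\alpha^{n-1})\wedge\mathsf{b}(\neg(\alpha^{n-1})))$; (V5) $\mathsf{b}(\neg(\alpha^\circ))=\mathsf{b}(\alpha)\wedge\mathsf{b}(\neg\alpha)$;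 (V6)$_n$ $\mathsf{b}(\alpha^{(n)})\wedge\mathsf{b}(\beta^{(n)})\le\mathsf{b}((\alpha\#\beta)^{(n)})$ for $\#\in\{\wedge,\vee,\to\}$. For $z\in|\mathcal{B}|^{n+1}$ with coordinates $z_{[i]}$: $B^{\mathcal{B}}_n=\{z: (\bigwedge_{i=1}^k z_{[i]})\vee z_{[k+1]}=1 \ \forall 1\le k\le n\}$, $D^{\mathcal{B}}_n=\{z\in B^{\mathcal{B}}_n:z_{[1]}=1\}$, $Boo^{\mathcal{B}}_n=\{z\in B^{\mathcal{B}}_n:z_{[1]}\wedge z_{[2]}=0\}$. Multioperations on $B^{\mathcal{B}}_n$: $\tilde\neg z=\{w\in B^{\mathcal{B}}_n: w_{[1]}=z_{[2]}, w_{[2]}\le z_{[1]}\}$; for $\#\in\{\wedge,\vee,\to\}$, $z\tilde\# w=\{u\in Boo^{\mathcal{B}}_n:u_{[1]}=z_{[1]}\#w_{[1]}\}$ if $z,w\in Boo^{\mathcal{B}}_n$, else $\{u\in B^{\mathcal{B}}_n:u_{[1]}=z_{[1]}\#w_{[1]}\}$. A valuation is a map $\nu$ from formulas to $B^{\mathcal{B}}_n$ with $\nu(\neg\alpha)\in\tilde\neg\nu(\alpha)$, $\nu(\alpha\#\beta)\in\nu(\alpha)\tilde\#\nu(\beta)$. $\mathcal{F}^{\mathcal{B}}_{C_n}$ is the set of valuations such that for all $\alpha,\beta$: (1) $\nu(\alpha\wedge\neg\alpha)_{[2]}=\nu(\alpha)_{[3]}$; (2) $\nu(\alpha^1)=(\nu(\alpha)_{[3]},\nu(\alpha)_{[1]}\wedge\nu(\alpha)_{[2]},\nu(\alpha)_{[4]},\dots,\nu(\alpha)_{[n+1]},\sim\bigwedge_{i=1}^{n+1}\nu(\alpha)_{[i]})$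 (for $n=1$ read $\nu(\alpha)_{[3]}$ as $\sim(\nu(\alpha)_{[1]}\wedge\nu(\alpha)_{[2]})$ and (2) as $\nu(\alpha^1)=(\sim(\nu(\alpha)_{[1]}\wedge\nu(\alpha)_{[2]}),\nu(\alpha)_{[1]}\wedge\nu(\alpha)_{[2]})$); (3) $\nu((\alpha^{(n)}\wedge\beta^{(n)})\to(\alpha\#\beta)^{(n)})\in D^{\mathcal{B}}_n$ for $\#\in\{\wedge,\vee,\to\}$. -}

module Defs where

open import Level using (_⊔_)
open import Data.Nat using (ℕ; zero; suc)
open import Data.Fin using (Fin; zero; suc; inject₁; fromℕ)
open import Data.Product using (_×_)
import Relation.Nullary as RN
open import Algebra.Lattice.Bundles using (BooleanAlgebra)

data BinOp : Set where
  and or imp : BinOp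

data Formula : Set where
  var  : ℕ → Formula
  neg  : Formula → Formula
  bin  : BinOp → Formula → Formula → Formula

_∧f_ : Formula → Formula → Formula
α ∧f β = bin and α β

_→f_ : Formula → Formula → Formula
α →f β = bin imp α β

pow : Formula → ℕ → Formula
pow α zero    = α
pow α (suc k) = neg (pow α k ∧f neg (pow α k))

circ : Formula → Formula
circ α = pow α 1

-- powP α k = α^(k+1) :  α^(1) = α^1, α^(k+1) = α^(k) ∧ α^(k+1)
powP : Formula → ℕ → Formula
powP α zero    = pow α 1
powP α (suc k) = powP α k ∧f pow α (suc (suc k))

snoc : ∀ {a} {A : Set a} {k : ℕ} → (Fin k → A) → A → Fin (suc k) → A
snoc {k = zero}  f x zero    = x
snoc {k = suc k} f x zero    = f zero
snoc {k = suc k} f x (suc i) = snoc (λ j → f (suc j)) x i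

module _ {c ℓ} (B : BooleanAlgebra c ℓ) where
  open BooleanAlgebra B

  _⇒B_ : Carrier → Carrier → Carrier
  a ⇒B b = (¬ a) ∨ b

  _≤B_ : Carrier → Carrier → Set ℓ
  a ≤B b = (a ∧ b) ≈ a

  NonTrivial : Set ℓ
  NonTrivial = RN.¬ (⊤ ≈ ⊥)

  semOp : BinOp → Carrier → Carrier → Carrier
  semOp and = _∧_
  semOp or  = _∨_
  semOp imp = _⇒B_

  -- meetUpTo z i = z_[1] ∧ ... ∧ z_[i+1]   (0-indexed coordinates)
  meetUpTo : ∀ {n} → (Fin (suc n) → Carrier) → Fin (suc n) → Carrier
  meetUpTo z zero = z zero
  meetUpTo {suc n} z (suc i) = z zero ∧ meetUpTo (λ j → z (suc j)) i

  meetAll : ∀ {n} → (Fin (suc n) → Carrier) → Carrier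
  meetAll {n} z = meetUpTo z (fromℕ n)

  -- Elements of |B|^(n+1) are functions Fin (suc n) → Carrier; coordinate z_[i] is z (i-1).
  -- z ∈ B_n : (⋀_{i=1}^k z_[i]) ∨ z_[k+1] = 1 for all 1 ≤ k ≤ n
  InB : (n : ℕ) → (Fin (suc n) → Carrier) → Set ℓ
  InB n z = (k : Fin n) → (meetUpTo z (inject₁ k) ∨ z (suc k)) ≈ ⊤

  InD : (n : ℕ) → (Fin (suc n) → Carrier) → Set ℓ
  InD n z = InB n z × (z zero ≈ ⊤)

  -- Boo_n  (here n = suc m, so coordinate [2] exists)
  InBoo : (m : ℕ) → (Fin (suc (suc m)) → Carrier) → Set ℓ
  InBoo m z = InB (suc m) z × ((z zero ∧ z (suc zero)) ≈ ⊥)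

  -- the tuple prescribed for ν(α^1) in condition (2), for n = suc m
  circVec : (m : ℕ) → (Fin (suc (suc m)) → Carrier) → Fin (suc (suc m)) → Carrier
  circVec zero z zero = ¬ (z zero ∧ z (suc zero))
  circVec zero z (suc zero) = z zero ∧ z (suc zero)
  circVec (suc k) z zero = z (suc (suc zero))
  circVec (suc k) z (suc zero) = z zero ∧ z (suc zero)
  circVec (suc k) z (suc (suc j)) =
    snoc (λ (i : Fin k) → z (suc (suc (suc i)))) (¬ (meetAll z)) j

  -- ν ∈ F^B_{C_n}, for n = suc m.  ν : Formula → |B|^(n+1)
  record InF (m : ℕ) (ν : Formula → Fin (suc (suc m)) → Carrier) : Set (c ⊔ ℓ) where
    field
      inB     : ∀ α → InB (suc m) (ν α)
      neg₁    : ∀ α → ν (neg α) zero ≈ ν α (suc zero)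
      neg₂    : ∀ α → ν (neg α) (suc zero) ≤B ν α zero
      bin₁    : ∀ o α β → ν (bin o α β) zero ≈ semOp o (ν α zero) (ν β zero)
      binBoo  : ∀ o α β → InBoo m (ν α) → InBoo m (ν β) → InBoo m (ν (bin o α β))
      -- (1)  ν(α ∧ ¬α)_[2] = ν(α)_[3]   (for n = 1, ν(α)_[3] := ~(ν(α)_[1] ∧ ν(α)_[2]))
      cond1   : ∀ α → ν (α ∧f neg α) (suc zero) ≈ circVec m (ν α) zero
      cond2   : ∀ α i → ν (circ α) i ≈ circVec m (ν α) i
      cond3   : ∀ o α β →
                InD (suc m) (ν ((powP α m ∧f powP β m) →f powP (bin o α β) m))

  record IsBValuation (m : ℕ) (b : Formula → Carrier) : Set (c ⊔ ℓ) where
    field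
      V1 : ∀ o α β → b (bin o α β) ≈ semOp o (b α) (b β)
      V2 : ∀ α → (¬ b α) ≤B b (neg α)
      V3 : ∀ α → b (neg (neg α)) ≤B b α
      V4 : ∀ α → b (pow α (suc m)) ≈ ¬ (b (pow α m) ∧ b (neg (pow α m)))
      V5 : ∀ α → b (neg (circ α)) ≈ (b α ∧ b (neg α))
      V6 : ∀ o α β → (b (powP α m) ∧ b (powP β m)) ≤B b (powP (bin o α β) m)

-- The first coordinate of ν commutes with ∧, ∨, → by the multioperations, and conditions (1) and (2)
-- give (V2), (V3), (V5); (V6) is condition (3), since b(x → y) = 1 means b x ≤ b y.  The only real
-- work is (V4).  Condition (2) says that ν(β°) is obtained from ν(β) by moving the third coordinate
-- to the front, merging the first two by ∧, shifting the rest left and appending ~⋀ν(β).  After n−1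
-- such steps starting from ν(α), the first two coordinates of ν(α^{n−1}) meet to ⋀ν(α) and the third
-- is ~⋀ν(α); condition (1) turns this into (V4).
module Submission where

open import Defs
open import Level using (Level)
open import Data.Nat using (ℕ; suc; zero; _+_)
open import Data.Nat.Properties using (+-suc; +-comm)
open import Data.Fin using (Fin; zero; suc; inject₁; fromℕ; toℕ)
open import Data.Fin.Properties using (toℕ-inject₁; toℕ-fromℕ)
open import Data.Fin.Induction using (<-weakInduction)
open import Data.Product using (_×_; _,_; proj₁; proj₂)
open import Algebra.Lattice.Bundles using (BooleanAlgebra)
open import Relation.Binary.PropositionalEquality as ≡ using (_≡_)
import Algebra.Lattice.Properties.BooleanAlgebra as BooleanAlgebraProperties
import Relation.Binary.Reasoning.Setoid as SetoidReasoning

snoc-inject₁ : ∀ {a} {A : Set a} {k} (f : Fin k → A) (x : A) (j : Fin k) →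
               snoc f x (inject₁ j) ≡ f j
snoc-inject₁ {k = suc k} f x zero    = ≡.refl
snoc-inject₁ {k = suc k} f x (suc j) = snoc-inject₁ (λ i → f (suc i)) x j

snoc-fromℕ : ∀ {a} {A : Set a} k (f : Fin k → A) (x : A) → snoc f x (fromℕ k) ≡ x
snoc-fromℕ zero    f x = ≡.refl
snoc-fromℕ (suc k) f x = snoc-fromℕ k (λ i → f (suc i)) x

module _ {c ℓ : Level} (B : BooleanAlgebra c ℓ) where
  open BooleanAlgebra B
  open BooleanAlgebraProperties B
  open SetoidReasoning setoid

  infix 4 _≤_
  _≤_ : Carrier → Carrier → Set ℓ
  _≤_ = _≤B_ B

  ≤-respˡ-≈ : ∀ {x y z} → x ≈ y → y ≤ z → x ≤ z
  ≤-respˡ-≈ {x} {y} {z} x≈y y≤z = begin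
    x ∧ z ≈⟨ ∧-congʳ x≈y ⟩
    y ∧ z ≈⟨ y≤z ⟩
    y     ≈⟨ sym x≈y ⟩
    x     ∎

  ≤-respʳ-≈ : ∀ {x y z} → y ≈ z → x ≤ y → x ≤ z
  ≤-respʳ-≈ y≈z x≤y = trans (∧-congˡ (sym y≈z)) x≤y

  ⇒≈⊤⇒≤ : ∀ {x y} → (¬ x ∨ y) ≈ ⊤ → x ≤ y
  ⇒≈⊤⇒≤ {x} {y} ¬x∨y≈⊤ = begin
    x ∧ y                 ≈⟨ ∨-identityˡ _ ⟨
    ⊥ ∨ (x ∧ y)           ≈⟨ ∨-congʳ (∧-complementʳ x) ⟨
    (x ∧ ¬ x) ∨ (x ∧ y)   ≈⟨ ∧-distribˡ-∨ x (¬ x) y ⟨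
    x ∧ (¬ x ∨ y)         ≈⟨ ∧-congˡ ¬x∨y≈⊤ ⟩
    x ∧ ⊤                 ≈⟨ ∧-identityʳ x ⟩
    x                     ∎

  ∨≈⊤⇒¬≤ : ∀ {x y} → (x ∨ y) ≈ ⊤ → ¬ x ≤ y
  ∨≈⊤⇒¬≤ x∨y≈⊤ = ⇒≈⊤⇒≤ (trans (∨-congʳ (¬-involutive _)) x∨y≈⊤)

  ∧-rotate : ∀ x y z → z ∧ (x ∧ y) ≈ x ∧ (y ∧ z)
  ∧-rotate x y z = trans (∧-comm z (x ∧ y)) (∧-assoc x y z)

  ∧-rotate-assoc : ∀ x y z w → z ∧ ((x ∧ y) ∧ w) ≈ x ∧ (y ∧ (z ∧ w))
  ∧-rotate-assoc x y z w = begin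
    z ∧ ((x ∧ y) ∧ w)  ≈⟨ ∧-assoc z (x ∧ y) w ⟨
    (z ∧ (x ∧ y)) ∧ w  ≈⟨ ∧-congʳ (∧-rotate x y z) ⟩
    (x ∧ (y ∧ z)) ∧ w  ≈⟨ ∧-assoc x (y ∧ z) w ⟩
    x ∧ ((y ∧ z) ∧ w)  ≈⟨ ∧-congˡ (∧-assoc y z w) ⟩
    x ∧ (y ∧ (z ∧ w))  ∎

  meetUpTo-cong : ∀ {n} {z z′ : Fin (suc n) → Carrier} → (∀ i → z i ≈ z′ i) →
                  ∀ i → meetUpTo B z i ≈ meetUpTo B z′ i
  meetUpTo-cong         z≈z′ zero    = z≈z′ zero
  meetUpTo-cong {suc n} z≈z′ (suc i) = ∧-cong (z≈z′ zero) (meetUpTo-cong (λ j → z≈z′ (suc j)) i)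

  meetUpTo-snoc : ∀ {k} (f : Fin (suc k) → Carrier) x (j : Fin (suc k)) →
                  meetUpTo B (snoc f x) (inject₁ j) ≡ meetUpTo B f j
  meetUpTo-snoc {zero}  f x zero    = ≡.refl
  meetUpTo-snoc {suc k} f x zero    = ≡.refl
  meetUpTo-snoc {suc k} f x (suc j) = ≡.cong (f zero ∧_) (meetUpTo-snoc (λ i → f (suc i)) x j)

  circVec-second : ∀ m (z : Fin (suc (suc m)) → Carrier) →
                   circVec B m z (suc zero) ≡ z zero ∧ z (suc zero)
  circVec-second zero    z = ≡.refl
  circVec-second (suc m) z = ≡.refl

  circVec-shift : ∀ {k} (z : Fin (suc (suc (suc k))) → Carrier) (j : Fin k) →
                  circVec B (suc k) z (suc (suc (inject₁ j))) ≡ z (suc (suc (suc j)))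
  circVec-shift z = snoc-inject₁ (λ i → z (suc (suc (suc i)))) _

  circVec-last : ∀ k (z : Fin (suc (suc (suc k))) → Carrier) →
                 circVec B (suc k) z (suc (suc (fromℕ k))) ≡ ¬ meetAll B z
  circVec-last k z = snoc-fromℕ k (λ i → z (suc (suc (suc i)))) _

  meetUpTo-circVec : ∀ {k} (z : Fin (suc (suc (suc k))) → Carrier) (i : Fin (suc k)) →
                     meetUpTo B (circVec B (suc k) z) (suc (inject₁ i)) ≈ meetUpTo B z (suc (suc i))
  meetUpTo-circVec         z zero    = ∧-rotate (z zero) (z (suc zero)) (z (suc (suc zero)))
  meetUpTo-circVec {suc k} z (suc i) = begin
    z₂ ∧ ((z₀ ∧ z₁) ∧ meetUpTo B (snoc z₃₊ (¬ meetAll B z)) (inject₁ i))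
      ≡⟨ ≡.cong (λ w → z₂ ∧ ((z₀ ∧ z₁) ∧ w)) (meetUpTo-snoc z₃₊ _ i) ⟩
    z₂ ∧ ((z₀ ∧ z₁) ∧ meetUpTo B z₃₊ i)
      ≈⟨ ∧-rotate-assoc z₀ z₁ z₂ _ ⟩
    z₀ ∧ (z₁ ∧ (z₂ ∧ meetUpTo B z₃₊ i)) ∎
    where
    z₀ z₁ z₂ : Carrier
    z₀ = z zero
    z₁ = z (suc zero)
    z₂ = z (suc (suc zero))

    z₃₊ : Fin (suc k) → Carrier
    z₃₊ j = z (suc (suc (suc j)))

  PrefixComplemented : ∀ {k} → Fin (suc k) → Carrier → (Fin (suc (suc (suc k))) → Carrier) → Set ℓ
  PrefixComplemented s a w = (meetUpTo B w (suc (inject₁ s)) ≈ a) × (w (suc (suc s)) ≈ ¬ a)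

  PrefixComplemented-cong : ∀ {k} {s : Fin (suc k)} {a w w′} → (∀ i → w′ i ≈ w i) →
                            PrefixComplemented s a w → PrefixComplemented s a w′
  PrefixComplemented-cong {s = s} w′≈w (meet≈a , next≈¬a) =
    trans (meetUpTo-cong w′≈w (suc (inject₁ s))) meet≈a , trans (w′≈w _) next≈¬a

  PrefixComplemented-start : ∀ k (z : Fin (suc (suc (suc k))) → Carrier) →
                             PrefixComplemented (fromℕ k) (meetAll B z) (circVec B (suc k) z)
  PrefixComplemented-start k z = meetUpTo-circVec z (fromℕ k) , reflexive (circVec-last k z)

  PrefixComplemented-circVec : ∀ {k a} (i : Fin k) w → PrefixComplemented (suc i) a w →
                               PrefixComplemented (inject₁ i) a (circVec B (suc k) w)
  PrefixComplemented-circVec i w (meet≈a , next≈¬a) =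
    trans (meetUpTo-circVec w (inject₁ i)) meet≈a , trans (reflexive (circVec-shift w i)) next≈¬a

  CircVecOrbit : ∀ k → (ℕ → Fin (suc (suc (suc k))) → Carrier) → Set ℓ
  CircVecOrbit k w = ∀ t i → w (suc t) i ≈ circVec B (suc k) (w t) i

  circVecOrbit-complemented : ∀ k (w : ℕ → Fin (suc (suc (suc k))) → Carrier) → CircVecOrbit k w →
                              w (suc k) (suc (suc zero)) ≈ ¬ (w (suc k) zero ∧ w (suc k) (suc zero))
  circVecOrbit-complemented k w orbit =
    trans next≈¬a (¬-cong (sym meet≈a))
    where
    a : Carrier
    a = meetAll B (w 0)

    Descends : Fin (suc k) → Set ℓ
    Descends s = ∀ t → PrefixComplemented s a (w t) → PrefixComplemented zero a (w (toℕ s + t))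

    descend-step : ∀ i → Descends (inject₁ i) → Descends (suc i)
    descend-step i descend-inject₁ t p =
      ≡.subst (λ u → PrefixComplemented zero a (w u))
              (≡.trans (≡.cong (_+ suc t) (toℕ-inject₁ i)) (+-suc (toℕ i) t))
              (descend-inject₁ (suc t)
                 (PrefixComplemented-cong (orbit t) (PrefixComplemented-circVec i (w t) p)))

    descend : ∀ s → Descends s
    descend = <-weakInduction Descends (λ t p → p) descend-step

    final : PrefixComplemented zero a (w (suc k))
    final = ≡.subst (λ u → PrefixComplemented zero a (w u))
                    (≡.trans (≡.cong (_+ 1) (toℕ-fromℕ k)) (+-comm k 1))
                    (descend (fromℕ k) 1
                       (PrefixComplemented-cong (orbit 0) (PrefixComplemented-start k (w 0))))

    meet≈a : (w (suc k) zero ∧ w (suc k) (suc zero)) ≈ a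
    meet≈a = proj₁ final

    next≈¬a : w (suc k) (suc (suc zero)) ≈ ¬ a
    next≈¬a = proj₂ final

  circVec-first-at-power : ∀ m {ν : Formula → Fin (suc (suc m)) → Carrier} → InF B m ν → ∀ α →
    circVec B m (ν (pow α m)) zero ≈ ¬ (ν (pow α m) zero ∧ ν (pow α m) (suc zero))
  circVec-first-at-power zero    F α = refl
  circVec-first-at-power (suc k) F α =
    circVecOrbit-complemented k _ (λ t → InF.cond2 F (pow α t))

  module _ {m : ℕ} {ν : Formula → Fin (suc (suc m)) → Carrier} (F : InF B m ν) where
    open InF F

    pow-suc-first : ∀ α → ν (pow α (suc m)) zero ≈ ¬ (ν (pow α m) zero ∧ ν (neg (pow α m)) zero)
    pow-suc-first α = begin
      ν (pow α (suc m)) zero                          ≈⟨ neg₁ _ ⟩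
      ν (pow α m ∧f neg (pow α m)) (suc zero)         ≈⟨ cond1 (pow α m) ⟩
      circVec B m (ν (pow α m)) zero                  ≈⟨ circVec-first-at-power m F α ⟩
      ¬ (ν (pow α m) zero ∧ ν (pow α m) (suc zero))   ≈⟨ ¬-cong (∧-congˡ (neg₁ (pow α m))) ⟨
      ¬ (ν (pow α m) zero ∧ ν (neg (pow α m)) zero)   ∎

    first-isBValuation : IsBValuation B m (λ α → ν α zero)
    first-isBValuation = record
      { V1 = bin₁
      ; V2 = λ α → ≤-respʳ-≈ (sym (neg₁ α)) (∨≈⊤⇒¬≤ (inB α zero))
      ; V3 = λ α → ≤-respˡ-≈ (neg₁ (neg α)) (neg₂ α)
      ; V4 = pow-suc-first
      ; V5 = λ α → begin
          ν (neg (circ α)) zero          ≈⟨ neg₁ (circ α) ⟩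
          ν (circ α) (suc zero)          ≈⟨ cond2 α (suc zero) ⟩
          circVec B m (ν α) (suc zero)   ≡⟨ circVec-second m (ν α) ⟩
          ν α zero ∧ ν α (suc zero)      ≈⟨ ∧-congˡ (neg₁ α) ⟨
          ν α zero ∧ ν (neg α) zero      ∎
      ; V6 = λ o α β → ≤-respˡ-≈ (sym (bin₁ and _ _))
               (⇒≈⊤⇒≤ (trans (sym (bin₁ imp _ _)) (proj₂ (cond3 o α β))))
      }

lemma4p10 : ∀ {c ℓ : Level} (m : ℕ) (B : BooleanAlgebra c ℓ) → NonTrivial B →
    (ν : Formula → Fin (suc (suc m)) → BooleanAlgebra.Carrier B) → InF B m ν →
    IsBValuation B m (λ α → ν α zero)
    × (∀ α → (BooleanAlgebra._≈_ B (ν α zero) (BooleanAlgebra.⊤ B) → InD B (suc m) (ν α))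
    × (InD B (suc m) (ν α) → BooleanAlgebra._≈_ B (ν α zero) (BooleanAlgebra.⊤ B)))
lemma4p10 m B _ ν F =
  first-isBValuation B F , λ α → (λ first≈⊤ → InF.inB F α , first≈⊤) , proj₂
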